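{- Let $H$ be a reflexive tournament and let $f$ be a $k$-ary polymorphism of $H$. If there is a vertex $z$ such that $f(x,\ldots,x)=z$ for every $x\in V(H)$, then $f(x_1,\ldots,x_k)=z$ for every $(x_1,\ldots,x_k)\in V(H)^k$.
   Context: A reflexive tournament is a digraph with a self-loop at every vertex in which for every two distinct vertices $u,v$ exactly one of $(u,v)$, $(v,u)$ is an edge. The direct power $H^k$ has vertex set $V(H)^k$ and an edge from $(x_1,\ldots,x_k)$ to $(y_1,\ldots,y_k)$ iff $(x_i,y_i)\in E(H)$ for all $i$. A $k$-ary polymorphism of $H$ is a homomorphism from $H^k$ to $H$. -}

module Defs where

open import Data.Nat using (ℕ)
open import Data.Fin using (Fin)
open import Data.Product using (_×_)
open import Data.Sum using (_⊎_)
open import Relation.Nullary using (¬_)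
open import Relation.Binary.PropositionalEquality using (_≡_; _≢_)

record Digraph : Set₁ where
  field
    n : ℕ
    E : Fin n → Fin n → Set

open Digraph public

Vertex : Digraph → Set
Vertex H = Fin (n H)

record IsReflexiveTournament (H : Digraph) : Set where
  field
    loop     : ∀ (v : Vertex H) → E H v v
    total    : ∀ (u v : Vertex H) → u ≢ v → E H u v ⊎ E H v u
    antisym  : ∀ (u v : Vertex H) → u ≢ v → ¬ (E H u v × E H v u)

PowerEdge : (H : Digraph) (k : ℕ) → (Fin k → Vertex H) → (Fin k → Vertex H) → Set
PowerEdge H k x y = ∀ (i : Fin k) → E H (x i) (y i)

IsPolymorphism : (H : Digraph) (k : ℕ) → ((Fin k → Vertex H) → Vertex H) → Set
IsPolymorphism H k f =
  ∀ (x y : Fin k → Vertex H) → PowerEdge H k x y → E H (f x) (f y)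

-- If L → x → U in H^k and f L = f U = z, then z → f x → z, so f x = z because
-- a tournament has no 2-cycles. By induction on j, this gives f x = z for every
-- tuple x whose coordinates from the j-th on all equal some c: for j = 0 squeeze
-- x between the constant tuple c and itself. For the step, let a be the j-th
-- coordinate and orient the edge between a and c as p → q; overwriting the
-- coordinates from the j-th on by p, resp. q, gives tuples L → x → U covered by
-- the induction hypothesis.
module Submission where

open import Defs
open import Data.Nat using (ℕ; zero; suc; _<_; _≤_; _<?_; z≤n)
open import Data.Nat.Properties using (≮⇒≥; <⇒≱; m≤n⇒m<n∨m≡n; ≤-refl; <⇒≤)
open import Data.Fin using (Fin; toℕ; fromℕ<; _≟_)
open import Data.Fin.Properties using (toℕ-injective; toℕ-fromℕ<; toℕ<n)
open import Data.Product using (_,_)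
open import Data.Sum using (_⊎_; inj₁; inj₂; [_,_]′)
open import Data.Empty using (⊥-elim)
open import Function using (flip)
open import Relation.Nullary using (yes; no)
open import Relation.Binary using (Rel; Reflexive)
open import Relation.Binary.PropositionalEquality
  using (_≡_; refl; sym; trans; subst; cong)

module _ {A : Set} {k : ℕ} where

  ConstantFrom : ℕ → (Fin k → A) → A → Set
  ConstantFrom j x c = ∀ i → j ≤ toℕ i → x i ≡ c

  overwriteFrom : ℕ → (Fin k → A) → A → Fin k → A
  overwriteFrom j x c i with toℕ i <? j
  ... | yes _ = x i
  ... | no  _ = c

  overwriteFrom-constantFrom : ∀ j x c → ConstantFrom j (overwriteFrom j x c) c
  overwriteFrom-constantFrom j x c i j≤i with toℕ i <? j
  ... | yes i<j = ⊥-elim (<⇒≱ i<j j≤i)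
  ... | no  _   = refl

  overwriteFrom-related : ∀ {ℓ} (R : Rel A ℓ) → Reflexive R → ∀ j x {a} →
                          (∀ i → j ≤ toℕ i → R a (x i)) →
                          ∀ i → R (overwriteFrom j x a i) (x i)
  overwriteFrom-related R refl′ j x a≈x i with toℕ i <? j
  ... | yes _   = refl′
  ... | no  i≮j = a≈x i (≮⇒≥ i≮j)

  constantFrom-suc-tail : ∀ {ℓ} {P : A → Set ℓ} {j x c} (j<k : j < k) →
                          ConstantFrom (suc j) x c →
                          P (x (fromℕ< j<k)) → P c → ∀ i → j ≤ toℕ i → P (x i)
  constantFrom-suc-tail {P = P} {x = x} j<k x≡c Pa Pc i j≤i with m≤n⇒m<n∨m≡n j≤i
  ... | inj₁ j<i = subst P (sym (x≡c i j<i)) Pc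
  ... | inj₂ j≡i = subst P (cong x (toℕ-injective (trans (toℕ-fromℕ< j<k) j≡i))) Pa

module _ {H : Digraph} (T : IsReflexiveTournament H) where

  open IsReflexiveTournament T

  edges⇒≡ : ∀ {u v} → E H u v → E H v u → u ≡ v
  edges⇒≡ {u} {v} uv vu with u ≟ v
  ... | yes u≡v = u≡v
  ... | no  u≢v = ⊥-elim (antisym u v u≢v (uv , vu))

  connex : ∀ u v → E H u v ⊎ E H v u
  connex u v with u ≟ v
  ... | yes refl = inj₁ (loop u)
  ... | no  u≢v  = total u v u≢v

  polymorphism-squeeze : ∀ {k f} → IsPolymorphism H k f → ∀ {L x U z} →
                         PowerEdge H k L x → PowerEdge H k x U →
                         f L ≡ z → f U ≡ z → f x ≡ z
  polymorphism-squeeze {f = f} pol {L} {x} {U} L→x x→U fL≡z fU≡z = edges⇒≡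
    (subst (E H (f x)) fU≡z (pol x U x→U))
    (subst (flip (E H) (f x)) fL≡z (pol L x L→x))

  module _ {k} {f : (Fin k → Vertex H) → Vertex H} (pol : IsPolymorphism H k f)
           {z} (diag : ∀ x → f (λ _ → x) ≡ z) where

    constantFrom⇒≡ : ∀ j → j ≤ k → ∀ x c → ConstantFrom j x c → f x ≡ z
    constantFrom⇒≡ zero    _   x c x≡c =
      polymorphism-squeeze pol
        (λ i → subst (E H c) (sym (x≡c i z≤n)) (loop c))
        (λ i → subst (flip (E H) c) (sym (x≡c i z≤n)) (loop c))
        (diag c) (diag c)
    constantFrom⇒≡ (suc j) j<k x c x≡c =
      [ (λ a→c → between (tail {P = E H a} (loop a) a→c)
                         (tail {P = flip (E H) c} a→c (loop c)))
      , (λ c→a → between (tail {P = E H c} c→a (loop c))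
                         (tail {P = flip (E H) a} (loop a) c→a))
      ]′ (connex a c)
      where
      a : Vertex H
      a = x (fromℕ< j<k)

      tail : ∀ {ℓ} {P : Vertex H → Set ℓ} → P a → P c → ∀ i → j ≤ toℕ i → P (x i)
      tail = constantFrom-suc-tail j<k x≡c

      between : ∀ {p q} → (∀ i → j ≤ toℕ i → E H p (x i)) →
                (∀ i → j ≤ toℕ i → E H (x i) q) → f x ≡ z
      between {p} {q} p→x x→q =
        polymorphism-squeeze pol
          (overwriteFrom-related (E H) (loop _) j x p→x)
          (overwriteFrom-related (flip (E H)) (loop _) j x x→q)
          (constantFrom⇒≡ j (<⇒≤ j<k) _ p (overwriteFrom-constantFrom j x p))
          (constantFrom⇒≡ j (<⇒≤ j<k) _ q (overwriteFrom-constantFrom j x q))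

lemma2p1 : (H : Digraph) → IsReflexiveTournament H → (k : ℕ)
    → (f : (Fin k → Vertex H) → Vertex H) → IsPolymorphism H k f
    → (z : Vertex H) → (∀ (x : Vertex H) → f (λ _ → x) ≡ z)
    → ∀ (xs : Fin k → Vertex H) → f xs ≡ z
lemma2p1 H T k f pol z diag xs =
  constantFrom⇒≡ T pol diag k ≤-refl xs z (λ i k≤i → ⊥-elim (<⇒≱ (toℕ<n i) k≤i))
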